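{- Let $x$ be a feasible solution of the distance LP for a Directed Multicut instance with supply graph $G=(V,E)$ and demand graph $H=(V,F)$, and let $k\ge1$. If for some $v\in V$ there exist $u_1,\dots,u_k\in V$ such that the values $d_1(u_1,v),\dots,d_1(u_k,v)$ are all nonzero and pairwise distinct, then $H$ contains an induced $k$-matching-extension.
   Context: Directed Multicut: directed supply graph $G=(V,E)$ with nonnegative edge weights, directed demand graph $H=(V,F)$; distance LP: $x_e\ge0$ and $\sum_{e\in p}x_e\ge1$ for every directed path $p$ from $s$ to $t$ in $G$ with $(s,t)\in F$. $d(u,v)$ denotes the shortest-path distance from $u$ to $v$ in $G$ with edge lengths $x_e$. For $u,v\in V$, $d_1(u,v):=\max\bigl(0,\,1-\min_{v'\in V:\ (u,v')\in F} d(v,v')\bigr)$, and $d_1(u,v):=0$ for all $v$ if $u$ has no outgoing edge in $F$. A directed graph $H=(V,F)$ contains an induced $k$-matching-extension if there are sets $\{s_1,\dots,s_k\}\subseteq V$ and $\{t_1,\dots,t_k\}\subseteq V$ (the $s_i$ pairwise distinct, the $t_i$ pairwise distinct, possibly $s_i=t_j$ for some $i\ne j$) such that $(s_i,t_i)\in F$ for all $i$ and $(s_i,t_j)\notin F$ for all $i>j$.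
   Formalization: The feasible solution x of the distance LP and the edge weights take rational values. -}

module Defs where

open import Data.Nat using (ℕ)
open import Data.Fin using (Fin; toℕ)
open import Data.Bool using (Bool; true; false)
open import Data.Maybe using (Maybe; just; nothing)
open import Data.List using (List; foldr)
open import Data.Fin using (_<_)
open import Data.Product using (Σ; _×_; _,_)
open import Data.Empty using (⊥)
open import Data.Rational using (ℚ; 0ℚ; 1ℚ; _+_; _-_; _⊔_; _⊓_; _≤_)
open import Relation.Binary.PropositionalEquality using (_≡_)
open import Function.Definitions using (Injective)
open import Data.List using (allFin)

record Digraph (n : ℕ) : Set where
  field
    m   : ℕ
    src : Fin m → Fin n
    tgt : Fin m → Fin n
open Digraph public

Demand : ℕ → Set
Demand n = Fin n → Fin n → Bool

data Path {n : ℕ} (G : Digraph n) : Fin n → Fin n → Set where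
  []  : ∀ {u} → Path G u u
  _∷_ : ∀ {u v} (e : Fin (m G)) → {src G e ≡ u} → Path G (tgt G e) v → Path G u v

len : ∀ {n} {G : Digraph n} → (Fin (m G) → ℚ) → ∀ {u v} → Path G u v → ℚ
len x []      = 0ℚ
len x (e ∷ p) = x e + len x p

Feasible : ∀ {n} (G : Digraph n) (F : Demand n) → (Fin (m G) → ℚ) → Set
Feasible {n} G F x =
  ((e : Fin (m G)) → 0ℚ ≤ x e) ×
  ((s t : Fin n) → F s t ≡ true → (p : Path G s t) → 1ℚ ≤ len x p)

-- Extended rationals ℚ ∪ {∞}: nothing = ∞.
ℚ∞ : Set
ℚ∞ = Maybe ℚ

min∞ : ℚ∞ → ℚ∞ → ℚ∞
min∞ nothing  b        = b
min∞ (just a) nothing  = just a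
min∞ (just a) (just b) = just (a ⊓ b)

IsDistValue : ∀ {n} (G : Digraph n) → (Fin (m G) → ℚ) → Fin n → Fin n → ℚ∞ → Set
IsDistValue G x u v nothing  = Path G u v → ⊥
IsDistValue G x u v (just q) =
  Σ (Path G u v) (λ p → len x p ≡ q) × ((p : Path G u v) → q ≤ len x p)

IsShortestDist : ∀ {n} (G : Digraph n) → (Fin (m G) → ℚ) → (Fin n → Fin n → ℚ∞) → Set
IsShortestDist {n} G x D = (u v : Fin n) → IsDistValue G x u v (D u v)

minDemandDist : ∀ {n} → Demand n → (Fin n → Fin n → ℚ∞) → Fin n → Fin n → ℚ∞
minDemandDist {n} F D u v = foldr step nothing (allFin n)
  where
  step : Fin n → ℚ∞ → ℚ∞
  step v' acc with F u v'
  ... | true  = min∞ (D v v') acc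
  ... | false = acc

-- d₁(u,v) = max(0, 1 - min_{(u,v') ∈ F} d(v,v')); 0 if that min is ∞
-- (in particular 0 if u has no outgoing demand edge).
d₁ : ∀ {n} → Demand n → (Fin n → Fin n → ℚ∞) → Fin n → Fin n → ℚ
d₁ F D u v with minDemandDist F D u v
... | nothing = 0ℚ
... | just q  = 0ℚ ⊔ (1ℚ - q)

HasInducedMatchingExtension : ∀ {n} → Demand n → ℕ → Set
HasInducedMatchingExtension {n} F k =
  Σ (Fin k → Fin n) λ s → Σ (Fin k → Fin n) λ t →
    Injective _≡_ _≡_ s × Injective _≡_ _≡_ t ×
    ((i : Fin k) → F (s i) (t i) ≡ true) ×
    ((i j : Fin k) → j < i → F (s i) (t j) ≡ false)

-- Each u i has a demand target t i, (u i, t i) ∈ F, nearest to v: q i = d (v, t i)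
-- is the minimum of d (v, ·) over the demand targets of u i, and
-- d₁ (u i) v = max (0, 1 - q i), so the q i are pairwise distinct.  Listing the
-- demand edges (u i, t i) by increasing q i gives the extension: if (u i, t j) ∈ F
-- then q i ≤ d (v, t j) = q j by minimality, so j does not come strictly before i.
{-# OPTIONS --safe #-}
module Submission where

open import Defs
open import Data.Nat using (ℕ; _≥_; zero; suc; s≤s)
open import Data.Fin using (Fin; zero; suc; punchIn; _<_)
open import Data.Fin.Properties using (punchIn-injective; punchInᵢ≢i; <⇒≢)
open import Data.Rational using (ℚ; 0ℚ; 1ℚ; _≤_; _⊔_; _-_)
open import Data.Rational.Properties using (≤-refl; ≤-trans; ⊓-sel; p⊓q≤p; p⊓q≤q; ≤-decTotalOrder)
open import Data.Bool using (true; false; if_then_else_)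
open import Data.Maybe using (just; nothing)
open import Data.List using (List; []; _∷_; foldr; map; allFin)
open import Data.List.Membership.Propositional using (_∈_)
open import Data.List.Membership.Propositional.Properties using (∈-allFin; ∈-map⁺; ∈-map⁻)
open import Data.List.Relation.Unary.Any using (here; there)
import Data.List.Relation.Unary.All as All
import Data.List.Extrema as Extrema
open import Data.Product using (Σ; ∃; _×_; _,_; proj₁; proj₂)
open import Data.Sum as Sum using (_⊎_; inj₁; inj₂)
open import Function using (_∘_)
open import Function.Definitions using (Injective)
import Level
open import Relation.Binary.Bundles using (TotalOrder; DecTotalOrder)
open import Relation.Binary.PropositionalEquality
  using (_≡_; _≢_; refl; sym; trans; cong; subst; subst₂; module ≡-Reasoning)
open import Relation.Nullary using (contradiction)
open import Relation.Binary.Construct.Add.Supremum.NonStrict _≤_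
  using (_≤⁺_; [_]; _≤⊤⁺; [≤]-injective; ≤⁺-trans)

module _ {c ℓ₁ ℓ₂} (O : TotalOrder c ℓ₁ ℓ₂) where
  open TotalOrder O using (Carrier; _≈_; antisym) renaming (_≤_ to _≼_)
  open Extrema O using (argmin; f[argmin]≤f[xs])

  argmin-minimal : ∀ {k} (f : Fin (suc k) → Carrier) (i : Fin (suc k)) →
    f (argmin f zero (allFin (suc k))) ≼ f i
  argmin-minimal f i = All.lookup (f[argmin]≤f[xs] zero (allFin _)) (∈-allFin i)

  record Sorting {k : ℕ} (f : Fin k → Carrier) : Set (c Level.⊔ ℓ₂) where
    field
      order           : Fin k → Fin k
      order-injective : Injective _≡_ _≡_ order
      order-ascending : ∀ {i j} → i < j → f (order i) ≼ f (order j)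

  sorting : ∀ {k} (f : Fin k → Carrier) → Sorting f
  sorting {zero}  f = record
    { order = λ () ; order-injective = λ { {()} } ; order-ascending = λ { {()} } }
  sorting {suc k} f = record
    { order = σ ; order-injective = σ-injective ; order-ascending = σ-ascending }
    where
    least : Fin (suc k)
    least = argmin f zero (allFin (suc k))

    open Sorting (sorting (f ∘ punchIn least)) renaming
      (order to σ′; order-injective to σ′-injective; order-ascending to σ′-ascending)

    σ : Fin (suc k) → Fin (suc k)
    σ zero    = least
    σ (suc i) = punchIn least (σ′ i)

    σ-injective : Injective _≡_ _≡_ σ
    σ-injective {zero}  {zero}  _ = refl
    σ-injective {zero}  {suc j} e = contradiction (sym e) (punchInᵢ≢i least (σ′ j))
    σ-injective {suc i} {zero}  e = contradiction e (punchInᵢ≢i least (σ′ i))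
    σ-injective {suc i} {suc j} e = cong suc (σ′-injective (punchIn-injective least _ _ e))

    σ-ascending : ∀ {i j} → i < j → f (σ i) ≼ f (σ j)
    σ-ascending {zero}  {suc j} _       = argmin-minimal f (σ (suc j))
    σ-ascending {suc i} {suc j} (s≤s p) = σ′-ascending p

  minimalMatching⇒HasInducedMatchingExtension :
    ∀ {n k} (F : Demand n) (s t : Fin k → Fin n) (q : Fin k → Carrier) →
    Injective _≡_ _≈_ q →
    (∀ i → F (s i) (t i) ≡ true) →
    (∀ i j → F (s i) (t j) ≡ true → q i ≼ q j) →
    HasInducedMatchingExtension F k
  minimalMatching⇒HasInducedMatchingExtension F s t q q-injective matched minimal =
    s ∘ σ , t ∘ σ , σ-injective ∘ s-injective , σ-injective ∘ t-injective , matched ∘ σ , unmatched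
    where
    open Sorting (sorting q) renaming
      (order to σ; order-injective to σ-injective; order-ascending to σ-ascending)

    crossing⇒≡ : ∀ {i j} → F (s i) (t j) ≡ true → F (s j) (t i) ≡ true → i ≡ j
    crossing⇒≡ sᵢtⱼ sⱼtᵢ = q-injective (antisym (minimal _ _ sᵢtⱼ) (minimal _ _ sⱼtᵢ))

    s-injective : Injective _≡_ _≡_ s
    s-injective {i} {j} sᵢ≡sⱼ = crossing⇒≡
      (subst (λ x → F x (t j) ≡ true) (sym sᵢ≡sⱼ) (matched j))
      (subst (λ x → F x (t i) ≡ true) sᵢ≡sⱼ (matched i))

    t-injective : Injective _≡_ _≡_ t
    t-injective {i} {j} tᵢ≡tⱼ = crossing⇒≡
      (subst (λ x → F (s i) x ≡ true) tᵢ≡tⱼ (matched i))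
      (subst (λ x → F (s j) x ≡ true) (sym tᵢ≡tⱼ) (matched j))

    unmatched : ∀ i j → j < i → F (s (σ i)) (t (σ j)) ≡ false
    unmatched i j j<i with F (s (σ i)) (t (σ j)) in sᵢtⱼ
    ... | false = refl
    ... | true  = contradiction
      (sym (σ-injective (q-injective (antisym (minimal _ _ sᵢtⱼ) (σ-ascending j<i)))))
      (<⇒≢ j<i)

min∞-sel : ∀ a b → min∞ a b ≡ a ⊎ min∞ a b ≡ b
min∞-sel nothing  b        = inj₂ refl
min∞-sel (just a) nothing  = inj₁ refl
min∞-sel (just a) (just b) = Sum.map (cong just) (cong just) (⊓-sel a b)

min∞-≤ˡ : ∀ a b → min∞ a b ≤⁺ a
min∞-≤ˡ nothing  b        = b ≤⊤⁺
min∞-≤ˡ (just a) nothing  = [ ≤-refl ]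
min∞-≤ˡ (just a) (just b) = [ p⊓q≤p a b ]

min∞-≤ʳ : ∀ a b → min∞ a b ≤⁺ b
min∞-≤ʳ nothing  nothing  = nothing ≤⊤⁺
min∞-≤ʳ nothing  (just b) = [ ≤-refl ]
min∞-≤ʳ (just a) nothing  = just a ≤⊤⁺
min∞-≤ʳ (just a) (just b) = [ p⊓q≤q a b ]

minimum∞ : List ℚ∞ → ℚ∞
minimum∞ = foldr min∞ nothing

minimum∞-≤ : ∀ {x xs} → x ∈ xs → minimum∞ xs ≤⁺ x
minimum∞-≤ {xs = x ∷ xs} (here refl) = min∞-≤ˡ x (minimum∞ xs)
minimum∞-≤ {xs = y ∷ xs} (there x∈xs) =
  ≤⁺-trans ≤-trans (min∞-≤ʳ y (minimum∞ xs)) (minimum∞-≤ x∈xs)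

minimum∞-∈ : ∀ {q} xs → minimum∞ xs ≡ just q → just q ∈ xs
minimum∞-∈ (x ∷ xs) min≡q with min∞-sel x (minimum∞ xs)
... | inj₁ min≡x  = here (trans (sym min≡q) min≡x)
... | inj₂ min≡xs = there (minimum∞-∈ xs (trans (sym min≡xs) min≡q))

module _ {n : ℕ} (F : Demand n) (D : Fin n → Fin n → ℚ∞) (u v : Fin n) where

  demandDist : Fin n → ℚ∞
  demandDist w = if F u w then D v w else nothing

  private
    -- The fold step of minDemandDist is local to its where block; unifying with refl names it.
    minDemandDist-foldr :
      Σ (Fin n → ℚ∞ → ℚ∞) λ step → minDemandDist F D u v ≡ foldr step nothing (allFin n)
    minDemandDist-foldr = _ , refl

    step : Fin n → ℚ∞ → ℚ∞
    step = proj₁ minDemandDist-foldr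

    foldr-step : ∀ ws → foldr step nothing ws ≡ minimum∞ (map demandDist ws)
    foldr-step []       = refl
    foldr-step (w ∷ ws) with F u w
    ... | true  = cong (min∞ (D v w)) (foldr-step ws)
    ... | false = foldr-step ws

  minDemandDist≡minimum∞ : minDemandDist F D u v ≡ minimum∞ (map demandDist (allFin n))
  minDemandDist≡minimum∞ = foldr-step (allFin n)

  demandDist≡just : ∀ {w q} → demandDist w ≡ just q → F u w ≡ true × D v w ≡ just q
  demandDist≡just {w} dist≡q with F u w
  ... | true = refl , dist≡q

  minDemandDist-attained : ∀ {q} → minDemandDist F D u v ≡ just q →
    ∃ λ w → F u w ≡ true × D v w ≡ just q
  minDemandDist-attained min≡q
    with w , _ , q≡dist ← ∈-map⁻ demandDist
           (minimum∞-∈ (map demandDist (allFin n)) (trans (sym minDemandDist≡minimum∞) min≡q))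
    = w , demandDist≡just (sym q≡dist)

  minDemandDist-minimal : ∀ {q w r} → minDemandDist F D u v ≡ just q →
    F u w ≡ true → D v w ≡ just r → q ≤ r
  minDemandDist-minimal {w = w} {r} min≡q uw∈F dist≡r =
    [≤]-injective (subst₂ _≤⁺_ min≡q demandDist≡r min≤demandDist)
    where
    min≤demandDist : minDemandDist F D u v ≤⁺ demandDist w
    min≤demandDist = subst (_≤⁺ demandDist w) (sym minDemandDist≡minimum∞)
      (minimum∞-≤ (∈-map⁺ demandDist (∈-allFin w)))

    demandDist≡r : demandDist w ≡ just r
    demandDist≡r rewrite uw∈F = dist≡r

  d₁≢0⇒finite : d₁ F D u v ≢ 0ℚ → ∃ λ q → minDemandDist F D u v ≡ just q
  d₁≢0⇒finite d₁≢0 with minDemandDist F D u v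
  ... | nothing = contradiction refl d₁≢0
  ... | just q  = q , refl

  d₁-finite : ∀ {q} → minDemandDist F D u v ≡ just q → d₁ F D u v ≡ 0ℚ ⊔ (1ℚ - q)
  d₁-finite min≡q with minDemandDist F D u v
  d₁-finite refl | just q = refl

ℚ-totalOrder : TotalOrder Level.0ℓ Level.0ℓ Level.0ℓ
ℚ-totalOrder = DecTotalOrder.totalOrder ≤-decTotalOrder

lemma4 : {n : ℕ} (G : Digraph n) (w : Fin (m G) → ℚ) (F : Demand n)
    (x : Fin (m G) → ℚ) → ((e : Fin (m G)) → 0ℚ ≤ w e) → Feasible G F x →
    (D : Fin n → Fin n → ℚ∞) → IsShortestDist G x D →
    (k : ℕ) → k ≥ 1 → (v : Fin n) (u : Fin k → Fin n) →
    ((i : Fin k) → d₁ F D (u i) v ≢ 0ℚ) →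
    Injective _≡_ _≡_ (λ i → d₁ F D (u i) v) →
    HasInducedMatchingExtension F k
lemma4 {n} _ _ F _ _ _ D _ k _ v u d₁≢0 d₁-injective =
  minimalMatching⇒HasInducedMatchingExtension ℚ-totalOrder F u t q q-injective matched minimal
  where
  q : Fin k → ℚ
  q i = proj₁ (d₁≢0⇒finite F D (u i) v (d₁≢0 i))

  min≡q : ∀ i → minDemandDist F D (u i) v ≡ just (q i)
  min≡q i = proj₂ (d₁≢0⇒finite F D (u i) v (d₁≢0 i))

  t : Fin k → Fin n
  t i = proj₁ (minDemandDist-attained F D (u i) v (min≡q i))

  matched : ∀ i → F (u i) (t i) ≡ true
  matched i = proj₁ (proj₂ (minDemandDist-attained F D (u i) v (min≡q i)))

  dist≡q : ∀ i → D v (t i) ≡ just (q i)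
  dist≡q i = proj₂ (proj₂ (minDemandDist-attained F D (u i) v (min≡q i)))

  minimal : ∀ i j → F (u i) (t j) ≡ true → q i ≤ q j
  minimal i j uᵢtⱼ∈F = minDemandDist-minimal F D (u i) v (min≡q i) uᵢtⱼ∈F (dist≡q j)

  q-injective : Injective _≡_ _≡_ q
  q-injective {i} {j} qᵢ≡qⱼ = d₁-injective (begin
    d₁ F D (u i) v      ≡⟨ d₁-finite F D (u i) v (min≡q i) ⟩
    0ℚ ⊔ (1ℚ - q i)     ≡⟨ cong (λ r → 0ℚ ⊔ (1ℚ - r)) qᵢ≡qⱼ ⟩
    0ℚ ⊔ (1ℚ - q j)     ≡⟨ d₁-finite F D (u j) v (min≡q j) ⟨
    d₁ F D (u j) v      ∎)
    where open ≡-Reasoning
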